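{- Let $Y,Z$ be Young diagrams. Then (1) $Z\boxminus Y\in\Delta(Z,Y)$, i.e., $Z\boxminus Y$ is a Young diagram with $Z\subseteq(Z\boxminus Y)\boxplus Y$; and (2) $Z\boxminus Y\subseteq Z$.
   Context: $\mathbb{Z}_+=\{0,1,2,\dots\}$. $(i,j)\preceq(i',j')$ iff $i\le i'$ and $j\le j'$. A Young diagram is a set $X\subseteq\mathbb{Z}_+^2$ such that $z'\in X$ and $z\preceq z'$ imply $z\in X$. $X^c=\mathbb{Z}_+^2\setminus X$. The infimal sum of Young diagrams is $X\boxplus Y=(X^c+Y^c)^c$ (Minkowski sum of complements, then complement in $\mathbb{Z}_+^2$). For Young diagrams $Y,Z$, $\Delta(Z,Y)$ is the set of all Young diagrams $X$ with $Z\subseteq X\boxplus Y$, and the infimal difference is $Z\boxminus Y=\bigcap_{X\in\Delta(Z,Y)}X$. -}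

module Defs where

open import Level using (Level; _⊔_; suc; 0ℓ)
open import Data.Nat using (ℕ; _≤_; _+_)
open import Data.Product using (_×_; _,_; ∃-syntax)
open import Relation.Nullary using (¬_)
open import Relation.Binary.PropositionalEquality using (_≡_)

Point : Set
Point = ℕ × ℕ

_≼_ : Point → Point → Set
(i , j) ≼ (i' , j') = (i ≤ i') × (j ≤ j')

_+ₚ_ : Point → Point → Point
(i , j) +ₚ (i' , j') = (i + i' , j + j')

Subset : (ℓ : Level) → Set (suc ℓ)
Subset ℓ = Point → Set ℓ

_⊆_ : ∀ {a b} → Subset a → Subset b → Set (a ⊔ b)
A ⊆ B = ∀ z → A z → B z

_ᶜ : ∀ {a} → Subset a → Subset a
(A ᶜ) z = ¬ A z

_+ᴹ_ : ∀ {a b} → Subset a → Subset b → Subset (a ⊔ b)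
(A +ᴹ B) z = ∃[ x ] ∃[ y ] (A x × B y × (x +ₚ y ≡ z))

IsYoung : ∀ {a} → Subset a → Set a
IsYoung X = ∀ z z' → X z' → z ≼ z' → X z

_⊞_ : ∀ {a b} → Subset a → Subset b → Subset (a ⊔ b)
X ⊞ Y = ((X ᶜ) +ᴹ (Y ᶜ)) ᶜ

Δ : ∀ {a b c} → Subset a → Subset b → Subset c → Set (a ⊔ b ⊔ c)
Δ Z Y X = IsYoung X × (Z ⊆ (X ⊞ Y))

-- infimal difference: intersection of all X ∈ Δ(Z,Y)
-- (X ranges over all Young diagrams, i.e. all subsets at level 0ℓ)
_⊟_ : Subset 0ℓ → Subset 0ℓ → Subset (suc 0ℓ)
(Z ⊟ Y) z = (X : Subset 0ℓ) → Δ Z Y X → X z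

module Submission where

-- The proof rests on
-- three general facts about intersections ⋂ F of a family F of subsets:
--   * ⋂ F lies inside every member of F;
--   * if every member of F is a Young diagram, so is ⋂ F;
--   * (classically) if W ⊆ X ⊞ Y for every member X of F, then
--     W ⊆ (⋂ F) ⊞ Y, i.e. the infimal sum turns intersections in its first
--     argument into intersections.
-- Together with the observation that a Young diagram X satisfies X ⊆ X ⊞ Y
-- for every Y (so Z itself belongs to Δ(Z,Y)), these give both parts of the
-- theorem: Z ⊟ Y is Young and covers Z by the second and third facts, and
-- Z ⊟ Y ⊆ Z by the first, applied to the member Z.

open import Defs
open import Level using (0ℓ; _⊔_; suc)
open import Data.Product using (_×_; _,_; proj₁; proj₂)
open import Data.Nat.Properties using (m≤m+n)
open import Axiom.ExcludedMiddle using (ExcludedMiddle)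
open import Relation.Nullary.Decidable using (decidable-stable)
open import Relation.Binary.PropositionalEquality using (refl)

≼-+ₚ : ∀ x y → x ≼ (x +ₚ y)
≼-+ₚ (i , j) (k , l) = m≤m+n i k , m≤m+n j l

-- A Young diagram is contained in its infimal sum with any set: if
-- z = a + b with a ∉ X, then a ≼ z ∈ X forces a ∈ X.
young⇒⊆⊞ : ∀ {a b} {X : Subset a} (Y : Subset b) → IsYoung X → X ⊆ (X ⊞ Y)
young⇒⊆⊞ Y youngX z zX (x , y , x∉X , _ , refl) = x∉X (youngX x z zX (≼-+ₚ x y))

⋂ : ∀ {ℓ} → (Subset 0ℓ → Set ℓ) → Subset (suc 0ℓ ⊔ ℓ)
⋂ F z = (X : Subset 0ℓ) → F X → X z

⋂-lower : ∀ {ℓ} {F : Subset 0ℓ → Set ℓ} {X : Subset 0ℓ} → F X → ⋂ F ⊆ X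
⋂-lower {X = X} FX z z∈⋂ = z∈⋂ X FX

⋂-young : ∀ {ℓ} (F : Subset 0ℓ → Set ℓ) →
  (∀ X → F X → IsYoung X) → IsYoung (⋂ F)
⋂-young F young z z' z'∈⋂ z≼z' X FX = young X FX z z' (z'∈⋂ X FX) z≼z'

-- Given a
-- decomposition w = x + y with y ∉ Y, each member X must contain x (else
-- w ∉ X ⊞ Y); excluded middle turns "x ∉ X is absurd" into x ∈ X.
⋂-⊞ : ∀ {ℓ w b} → ExcludedMiddle 0ℓ → (F : Subset 0ℓ → Set ℓ)
  {W : Subset w} {Y : Subset b} →
  (∀ X → F X → W ⊆ (X ⊞ Y)) → W ⊆ ((⋂ F) ⊞ Y)
⋂-⊞ em F covers z zW (x , y , x∉⋂ , y∉Y , sum) =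
  x∉⋂ λ X FX → decidable-stable em λ x∉X →
    covers X FX z zW (x , y , x∉X , y∉Y , sum)

self∈Δ : ∀ {a b} {Z : Subset a} (Y : Subset b) → IsYoung Z → Δ Z Y Z
self∈Δ Y youngZ = youngZ , young⇒⊆⊞ Y youngZ

lemma2p2 : ExcludedMiddle 0ℓ → (Y Z : Subset 0ℓ) → IsYoung Y → IsYoung Z →
    Δ Z Y (Z ⊟ Y) × ((Z ⊟ Y) ⊆ Z)
lemma2p2 em Y Z _ youngZ =
  (⋂-young (Δ Z Y) (λ _ → proj₁) , ⋂-⊞ em (Δ Z Y) (λ _ → proj₂)) ,
  ⋂-lower (self∈Δ Y youngZ)
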